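{- Let $G$ be a bipartite graph with bipartition $(X,Y)$ and let $k\ge 1$ be an integer with $k|Y|$ even. Let $W=X$ and define $f,g:V(G)\to\mathbb{Z}$ by $f(v)=2$, $g(v)=0$ for $v\in X$ and $f(v)=g(v)=k$ for $v\in Y$. Suppose $G$ has no partial parity $(g,f)$-factor with respect to $X$, and let $(A,B)$ be a biased barrier of $G$. Then: (i) $B\subseteq Y$; (ii) for every odd component $D$ of $G-(A\cup B)$ and every $v\in V(D)$, $e_G(v,B)\le 1$; (iii) for every even component $D$ of $G-(A\cup B)$ and every $v\in V(D)$, $e_G(v,B)=0$; (iv) for every $Z\subseteq A\cap X$ with $N_G(Z)\cap B=\emptyset$, we have $h(Z)\ge 2|Z|$.
   Context: For a graph $G$, $W\subseteq V(G)$ and $f,g:V(G)\to\mathbb{Z}$ with $g\le f$ and $g(v)\equiv f(v)\pmod 2$ for $v\in W$, a partial parity $(g,f)$-factor with respect to $W$ is a spanning subgraph $F$ with $g(v)\le d_F(v)\le f(v)$ for all $v$ and $d_F(v)\equiv f(v)\pmod 2$ for all $v\in W$. For disjoint $A,B\subseteq V(G)$, $e_G(S,T)$ is the number of edges between disjoint vertex sets $S,T$ (with $e_G(v,T)=e_G(\{v\},T)$ and $e_G(D,B)=e_G(V(D),B)$). A component $D$ of $G-(A\cup B)$ is odd if $\sum_{v\in V(D)}f(v)+e_G(D,B)\equiv 1\pmod 2$ and even otherwise. Define $\delta_G(A,B)=\sum_{v\in A}f(v)-\sum_{v\in B}g(v)+\sum_{v\in B}d_{G-A}(v)-h_W(A,B)$,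 where $h_W(A,B)$ is the number of odd components $D$ of $G-(A\cup B)$ such that $g(v)=f(v)$ for all $v\in V(D)\setminus W$. A barrier is a pair $(A,B)$ of disjoint subsets of $V(G)$ with $\delta_G(A,B)<0$. A biased barrier is a barrier $(A,B)$ such that, among all barriers, $\delta_G(A,B)$ is minimum, subject to this $|B|$ is minimum, and subject to both $|A|$ is maximum. For $Z\subseteq A\cap X$, $h(Z)=|N_G(Z)\cap B|+|\{D: D \text{ an odd component of } G-(A\cup B) \text{ with } e_G(Z,D)\ge 1\}|$. -}

module Defs where

open import Data.Bool using (Bool; true; false; _∧_; _∨_; not; if_then_else_)
open import Data.Nat as ℕ using (ℕ; zero; suc; _≡ᵇ_; _≤ᵇ_)
open import Data.Fin using (Fin; toℕ)
open import Data.List using (List; allFin; map; foldr)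
open import Data.Bool.ListAction using (any; all)
open import Data.Integer as ℤ using (ℤ; +_; ∣_∣)
open import Data.Integer.Divisibility using () renaming (_∣_ to _∣ℤ_)
open import Relation.Nullary.Decidable using (⌊_⌋)
open import Relation.Binary.PropositionalEquality using (_≡_)
open import Data.Product using (Σ; _×_)
open import Relation.Nullary using (¬_)

record Graph (n : ℕ) : Set where
  field
    adj   : Fin n → Fin n → Bool
    sym   : ∀ u v → adj u v ≡ adj v u
    irref : ∀ v → adj v v ≡ false
open Graph public

VSet : ℕ → Set
VSet n = Fin n → Bool

module _ {n : ℕ} where

  anyV : (Fin n → Bool) → Bool
  anyV p = any p (allFin n)

  allV : (Fin n → Bool) → Bool
  allV p = all p (allFin n)

  count : (Fin n → Bool) → ℕ
  count p = foldr (λ v s → (if p v then 1 else 0) ℕ.+ s) 0 (allFin n)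

  sumℕ : (Fin n → ℕ) → ℕ
  sumℕ h = foldr (λ v s → h v ℕ.+ s) 0 (allFin n)

  sumℤ : VSet n → (Fin n → ℤ) → ℤ
  sumℤ S h = foldr (λ v s → (if S v then h v else + 0) ℤ.+ s) (+ 0) (allFin n)

  _∪_ : VSet n → VSet n → VSet n
  (S ∪ T) v = S v ∨ T v

  -- e_G(S,T): number of edges between S and T (S, T disjoint)
  eG : Graph n → VSet n → VSet n → ℕ
  eG G S T = sumℕ (λ u → if S u then count (λ w → T w ∧ adj G u w) else 0)

  eV : Graph n → Fin n → VSet n → ℕ
  eV G v T = count (λ w → T w ∧ adj G v w)

  degMinus : Graph n → VSet n → Fin n → ℕ
  degMinus G A v = count (λ w → not (A w) ∧ adj G v w)

  nbhd : Graph n → VSet n → VSet n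
  nbhd G Z w = anyV (λ u → Z u ∧ adj G u w)

  step : Graph n → VSet n → VSet n → VSet n
  step G S R w = R w ∨ (S w ∧ anyV (λ v → R v ∧ adj G v w))

  iter : ℕ → (VSet n → VSet n) → VSet n → VSet n
  iter zero    F R = R
  iter (suc i) F R = F (iter i F R)

  single : Fin n → VSet n
  single u w = ⌊ toℕ u ℕ.≟ toℕ w ⌋

  -- vertex set of the component of G[S] containing u (for u ∈ S):
  -- all vertices reachable from u by paths inside S (n steps suffice).
  comp : Graph n → VSet n → Fin n → VSet n
  comp G S u = iter n (step G S) (single u)

  -- u is the least-indexed vertex of its component of G[S]
  -- (used to count each component exactly once)
  isRep : Graph n → VSet n → Fin n → Bool
  isRep G S u = S u ∧ allV (λ w → not (comp G S u w) ∨ (toℕ u ≤ᵇ toℕ w))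

  oddℤ : ℤ → Bool
  oddℤ z = (∣ z ∣ ℕ.% 2) ≡ᵇ 1

  isOddComp : Graph n → (Fin n → ℤ) → VSet n → VSet n → Bool
  isOddComp G f B D = oddℤ (sumℤ D f ℤ.+ + eG G D B)

  rest : VSet n → VSet n → VSet n
  rest A B v = not (A v ∨ B v)

  hW : Graph n → (Fin n → ℤ) → (Fin n → ℤ) → VSet n → VSet n → VSet n → ℕ
  hW G f g W A B =
    count (λ u → isRep G (rest A B) u
                 ∧ isOddComp G f B (comp G (rest A B) u)
                 ∧ allV (λ v → not (comp G (rest A B) u v) ∨ W v ∨ ⌊ g v ℤ.≟ f v ⌋))

  δ : Graph n → (Fin n → ℤ) → (Fin n → ℤ) → VSet n → VSet n → VSet n → ℤ
  δ G f g W A B =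
    sumℤ A f ℤ.- sumℤ B g ℤ.+ + sumℕ (λ v → if B v then degMinus G A v else 0)
      ℤ.- + hW G f g W A B

  Disjoint : VSet n → VSet n → Set
  Disjoint A B = ∀ v → A v ≡ true → B v ≡ false

  IsBarrier : Graph n → (Fin n → ℤ) → (Fin n → ℤ) → VSet n → VSet n → VSet n → Set
  IsBarrier G f g W A B = Disjoint A B × δ G f g W A B ℤ.< + 0

  IsBiasedBarrier : Graph n → (Fin n → ℤ) → (Fin n → ℤ) → VSet n → VSet n → VSet n → Set
  IsBiasedBarrier G f g W A B =
    IsBarrier G f g W A B ×
    (∀ A' B' → IsBarrier G f g W A' B' →
       (δ G f g W A B ℤ.≤ δ G f g W A' B') ×
       (δ G f g W A' B' ≡ δ G f g W A B → count B ℕ.≤ count B') ×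
       (δ G f g W A' B' ≡ δ G f g W A B → count B' ≡ count B → count A' ℕ.≤ count A))

  record SpanningSubgraph (G : Graph n) : Set where
    field
      sel    : Fin n → Fin n → Bool
      selSym : ∀ u v → sel u v ≡ sel v u
      selSub : ∀ u v → sel u v ≡ true → adj G u v ≡ true
  open SpanningSubgraph public

  degF : {G : Graph n} → SpanningSubgraph G → Fin n → ℕ
  degF F v = count (λ w → sel F v w)

  IsPartialParityFactor : (G : Graph n) → (Fin n → ℤ) → (Fin n → ℤ) → VSet n →
                          SpanningSubgraph G → Set
  IsPartialParityFactor G f g W F =
    (∀ v → g v ℤ.≤ + degF F v) ×
    (∀ v → + degF F v ℤ.≤ f v) ×
    (∀ v → W v ≡ true → (+ 2) ∣ℤ (f v ℤ.- + degF F v))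

  HasPartialParityFactor : Graph n → (Fin n → ℤ) → (Fin n → ℤ) → VSet n → Set
  HasPartialParityFactor G f g W = Σ (SpanningSubgraph G) (IsPartialParityFactor G f g W)

  hZ : Graph n → (Fin n → ℤ) → VSet n → VSet n → VSet n → ℕ
  hZ G f A B Z =
    count (λ w → nbhd G Z w ∧ B w)
    ℕ.+ count (λ u → isRep G (rest A B) u
                     ∧ isOddComp G f B (comp G (rest A B) u)
                     ∧ (1 ≤ᵇ eG G Z (comp G (rest A B) u)))

-- The specific f, g of Theorem 2.4; side v = true means v ∈ X, false means v ∈ Y.
fk : {n : ℕ} → (Fin n → Bool) → ℕ → Fin n → ℤ
fk side k v = if side v then + 2 else + k

gk : {n : ℕ} → (Fin n → Bool) → ℕ → Fin n → ℤ
gk side k v = if side v then + 0 else + k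

{-# OPTIONS --safe #-}
-- Each part compares the biased barrier (A, B) with a modified pair that it must not beat.
-- (i) For v ∈ B ∩ X we have g(v) = 0, so deleting v from B lowers Σ_B d_{G−A} by d_{G−A}(v)
-- and creates at most d_{G−A}(v) new odd components: δ does not grow while |B| drops.
-- (ii), (iii) A vertex v of a component D of G − (A ∪ B) with e(v, B) ≥ 1 lies in X by (i);
-- moving v into A costs f(v) = 2 and saves e(v, B). Since f(v) is even, D − v has odd weight
-- exactly when the parities of D and of e(v, B) differ, and then one of its pieces is odd;
-- in the two stated cases δ does not grow while |A| grows.
-- (iv) Removing Z from A lowers Σ_A f by 2|Z|, keeps Σ_B d_{G−A} as N(Z) ∩ B = ∅ and
-- creates at most h(Z) odd components, so h(Z) < 2|Z| would make δ smaller.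
module Submission where

open import Defs
open import Data.Bool using (Bool; true; false; not; _∧_; _∨_; _xor_; if_then_else_)
import Data.Bool as Bool
open import Data.Bool.Properties
  using ( ∧-conicalˡ; ∧-conicalʳ; ∧-identityʳ; ∧-zeroʳ; ∧-assoc; ∨-conicalˡ; ∨-identityʳ; ∨-zeroʳ
        ; ¬-not; T-≡; not-distribˡ-xor)
open import Data.Bool.ListAction using (any; all)
open import Data.Empty using (⊥; ⊥-elim)
open import Data.Fin using (Fin; toℕ; fromℕ<)
open import Data.Fin.Properties
  using (toℕ-injective; toℕ-inject; toℕ-fromℕ<; all?; ¬∀⟶∃¬; ¬∀⟶∃¬-smallest)
open import Data.Integer as ℤ using (ℤ; +_; _⊖_)
import Data.Integer.Properties as ℤ
open import Data.Integer.Tactic.RingSolver as ℤ-Solver using ()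
open import Data.List using (List; []; _∷_; foldr; length; allFin)
open import Data.List.Properties using (length-tabulate)
open import Data.List.Membership.Propositional using (_∈_)
open import Data.List.Membership.Propositional.Properties using (∈-allFin)
open import Data.List.Relation.Unary.Any using (here; there)
open import Data.List.Relation.Unary.All using (All; []; _∷_)
open import Data.List.Relation.Unary.AllPairs using (_∷_)
open import Data.List.Relation.Unary.Unique.Propositional using (Unique)
open import Data.List.Relation.Unary.Unique.Propositional.Properties using (allFin⁺)
open import Data.Nat as ℕ
  using (ℕ; zero; suc; _+_; _*_; _≤_; _<_; z≤n; s≤s; s≤s⁻¹; _≤ᵇ_; _≡ᵇ_; _%_; _≤?_)
open import Data.Nat.Properties
open import Data.Nat.DivMod using ([m+n]%n≡m%n)
open import Data.Nat.Divisibility using (_∣_)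
open import Data.Nat.Tactic.RingSolver using (solve-∀)
open import Data.Product using (_×_; _,_; proj₁; proj₂; ∃)
open import Data.Sum using (_⊎_; inj₁; inj₂)
open import Function.Bundles using (Equivalence)
import Relation.Binary.PropositionalEquality as Eq
open Eq hiding (sym)
open import Relation.Nullary using (¬_; yes; no)
open import Relation.Nullary.Decidable using (⌊_⌋; _→-dec_)

≡true⇒≢false : ∀ {b} → b ≡ true → b ≢ false
≡true⇒≢false refl ()

not-true⇒false : ∀ {b} → not b ≡ true → b ≡ false
not-true⇒false {false} _ = refl

false⇒not-true : ∀ {b} → b ≡ false → not b ≡ true
false⇒not-true refl = refl

∨-introˡ : ∀ {a} b → a ≡ true → a ∨ b ≡ true
∨-introˡ b refl = refl

∨-introʳ : ∀ a {b} → b ≡ true → a ∨ b ≡ true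
∨-introʳ true  _ = refl
∨-introʳ false e = e

∨-elim : ∀ a {b} → a ∨ b ≡ true → a ≡ true ⊎ b ≡ true
∨-elim true  _ = inj₁ refl
∨-elim false e = inj₂ e

∧-intro : ∀ {a b} → a ≡ true → b ≡ true → a ∧ b ≡ true
∧-intro refl refl = refl

∧-falseˡ : ∀ {a} b → a ≡ false → a ∧ b ≡ false
∧-falseˡ b refl = refl

nor-intro : ∀ {a b} → a ≡ false → b ≡ false → not (a ∨ b) ≡ true
nor-intro refl refl = refl

nor⇒falseˡ : ∀ {a b} → not (a ∨ b) ≡ true → a ≡ false
nor⇒falseˡ {false} _ = refl

nor⇒falseʳ : ∀ a {b} → not (a ∨ b) ≡ true → b ≡ false
nor⇒falseʳ false {false} _ = refl

ind : Bool → ℕ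
ind b = if b then 1 else 0

ind-mono : ∀ {a b} → (a ≡ true → b ≡ true) → ind a ≤ ind b
ind-mono {false} _ = z≤n
ind-mono {true}  h rewrite h refl = ≤-refl

ind-∧ : ∀ a b x → ind (a ∧ b) * x ≡ ind a * (ind b * x)
ind-∧ false b x = refl
ind-∧ true  b x = Eq.sym (+-identityʳ _)

ind-∧-* : ∀ a b → ind (a ∧ b) ≡ ind a * ind b
ind-∧-* false b = refl
ind-∧-* true  b = Eq.sym (+-identityʳ (ind b))

ind-∨ : ∀ a b x → ind (a ∨ b) * x ≤ ind a * x + ind b * x
ind-∨ false b x = ≤-refl
ind-∨ true  b x = m≤m+n _ _

ind-split : ∀ a b x → ind a * x ≡ ind (a ∧ b) * x + ind (a ∧ not b) * x
ind-split false b     x = refl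
ind-split true  true  x = Eq.sym (+-identityʳ _)
ind-split true  false x = refl

if≡ind* : ∀ b x → (if b then x else 0) ≡ ind b * x
if≡ind* false x = refl
if≡ind* true  x = Eq.sym (+-identityʳ x)

isOdd : ℕ → Bool
isOdd zero          = false
isOdd (suc zero)    = true
isOdd (suc (suc m)) = isOdd m

isOdd-suc : ∀ m → isOdd (suc m) ≡ not (isOdd m)
isOdd-suc zero          = refl
isOdd-suc (suc zero)    = refl
isOdd-suc (suc (suc m)) = isOdd-suc m

isOdd-+ : ∀ a b → isOdd (a + b) ≡ isOdd a xor isOdd b
isOdd-+ zero    b = refl
isOdd-+ (suc a) b rewrite isOdd-suc (a + b) | isOdd-+ a b | isOdd-suc a = not-distribˡ-xor (isOdd a) (isOdd b)

isOdd≡%2 : ∀ m → (m % 2 ≡ᵇ 1) ≡ isOdd m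
isOdd≡%2 zero          = refl
isOdd≡%2 (suc zero)    = refl
isOdd≡%2 (suc (suc m)) =
  trans (cong (λ z → z % 2 ≡ᵇ 1) (+-comm 2 m))
        (trans (cong (_≡ᵇ 1) ([m+n]%n≡m%n m 2)) (isOdd≡%2 m))

module _ {A : Set} where

  sumBy : (A → ℕ) → List A → ℕ
  sumBy h xs = foldr (λ x s → h x + s) 0 xs

  sumBy-cong : ∀ {h h′ : A → ℕ} xs → (∀ x → h x ≡ h′ x) → sumBy h xs ≡ sumBy h′ xs
  sumBy-cong []       e = refl
  sumBy-cong (x ∷ xs) e = cong₂ _+_ (e x) (sumBy-cong xs e)

  sumBy-mono : ∀ {h h′ : A → ℕ} xs → (∀ x → h x ≤ h′ x) → sumBy h xs ≤ sumBy h′ xs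
  sumBy-mono []       e = z≤n
  sumBy-mono (x ∷ xs) e = +-mono-≤ (e x) (sumBy-mono xs e)

  sumBy-+ : ∀ (h h′ : A → ℕ) xs → sumBy (λ x → h x + h′ x) xs ≡ sumBy h xs + sumBy h′ xs
  sumBy-+ h h′ []       = refl
  sumBy-+ h h′ (x ∷ xs) rewrite sumBy-+ h h′ xs = interchange (h x) (h′ x) (sumBy h xs) (sumBy h′ xs)
    where
    interchange : ∀ a b c d → a + b + (c + d) ≡ a + c + (b + d)
    interchange = solve-∀

  sumBy-*ʳ : ∀ (h : A → ℕ) c xs → sumBy (λ x → h x * c) xs ≡ sumBy h xs * c
  sumBy-*ʳ h c []       = refl
  sumBy-*ʳ h c (x ∷ xs) rewrite sumBy-*ʳ h c xs = Eq.sym (*-distribʳ-+ c (h x) (sumBy h xs))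

  sumBy-zero : ∀ xs → sumBy (λ _ → 0) xs ≡ 0
  sumBy-zero []       = refl
  sumBy-zero (x ∷ xs) = sumBy-zero xs

  sumBy-swap : ∀ (F : A → A → ℕ) xs ys →
               sumBy (λ x → sumBy (F x) ys) xs ≡ sumBy (λ y → sumBy (λ x → F x y) xs) ys
  sumBy-swap F []       ys = Eq.sym (sumBy-zero ys)
  sumBy-swap F (x ∷ xs) ys rewrite sumBy-swap F xs ys =
    Eq.sym (sumBy-+ (F x) (λ y → sumBy (λ x → F x y) xs) ys)

  sumBy≡0⇒≡0 : ∀ (h : A → ℕ) xs → sumBy h xs ≡ 0 → ∀ {x} → x ∈ xs → h x ≡ 0
  sumBy≡0⇒≡0 h (x ∷ xs) e (here refl) = m+n≡0⇒m≡0 (h x) e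
  sumBy≡0⇒≡0 h (x ∷ xs) e (there m)   = sumBy≡0⇒≡0 h xs (m+n≡0⇒n≡0 (h x) e) m

  ∈⇒≤sumBy : ∀ (h : A → ℕ) xs → ∀ {x} → x ∈ xs → h x ≤ sumBy h xs
  ∈⇒≤sumBy h (x ∷ xs) (here refl) = m≤m+n (h x) _
  ∈⇒≤sumBy h (x ∷ xs) (there m)   = ≤-trans (∈⇒≤sumBy h xs m) (m≤n+m _ (h x))

  sumBy≤length : ∀ (h : A → ℕ) xs → (∀ x → h x ≤ 1) → sumBy h xs ≤ length xs
  sumBy≤length h []       b = z≤n
  sumBy≤length h (x ∷ xs) b = +-mono-≤ (b x) (sumBy≤length h xs b)

  sumBy-ind≤1 : ∀ (p : A → Bool) xs → Unique xs →
                (∀ x y → p x ≡ true → p y ≡ true → x ≡ y) → sumBy (λ x → ind (p x)) xs ≤ 1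
  sumBy-ind≤1 p []       _         _   = z≤n
  sumBy-ind≤1 p (x ∷ xs) (x∉ ∷ u) one with p x in px
  ... | false = sumBy-ind≤1 p xs u one
  ... | true  = ≤-reflexive (cong suc (none xs x∉))
    where
    none : ∀ ys → All (x ≢_) ys → sumBy (λ y → ind (p y)) ys ≡ 0
    none []       _          = refl
    none (y ∷ ys) (x≢y ∷ x∉) with p y in py
    ... | true  = ⊥-elim (x≢y (one x y px py))
    ... | false = none ys x∉

  any-intro : ∀ (p : A → Bool) xs {x} → x ∈ xs → p x ≡ true → any p xs ≡ true
  any-intro p (y ∷ xs) (here refl) e = ∨-introˡ _ e
  any-intro p (y ∷ xs) (there m)   e = ∨-introʳ (p y) (any-intro p xs m e)

  any-elim : ∀ (p : A → Bool) xs → any p xs ≡ true → ∃ λ x → p x ≡ true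
  any-elim p (y ∷ xs) e with ∨-elim (p y) e
  ... | inj₁ e′ = y , e′
  ... | inj₂ e′ = any-elim p xs e′

  all-intro : ∀ (p : A → Bool) xs → (∀ x → p x ≡ true) → all p xs ≡ true
  all-intro p []       h = refl
  all-intro p (y ∷ xs) h rewrite h y = all-intro p xs h

  all-elim : ∀ (p : A → Bool) xs {x} → x ∈ xs → all p xs ≡ true → p x ≡ true
  all-elim p (y ∷ xs) (here refl) e = ∧-conicalˡ (p y) _ e
  all-elim p (y ∷ xs) (there m)   e = all-elim p xs m (∧-conicalʳ (p y) _ e)

  all-cong : ∀ (p q : A → Bool) xs → (∀ x → p x ≡ q x) → all p xs ≡ all q xs
  all-cong p q []       h = refl
  all-cong p q (y ∷ xs) h rewrite h y | all-cong p q xs h = refl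

module _ {n : ℕ} where

  _⊆_ : VSet n → VSet n → Set
  P ⊆ Q = ∀ w → P w ≡ true → Q w ≡ true

  ⊆-or-witness : (P Q : VSet n) → P ⊆ Q ⊎ ∃ λ w → P w ≡ true × Q w ≡ false
  ⊆-or-witness P Q with all? (λ w → (P w Bool.≟ true) →-dec (Q w Bool.≟ true))
  ... | yes P⊆Q = inj₁ P⊆Q
  ... | no P⊈Q with ¬∀⟶∃¬ n _ (λ w → (P w Bool.≟ true) →-dec (Q w Bool.≟ true)) P⊈Q
  ...   | w , ¬imp with P w in Pw | Q w in Qw
  ...     | true  | true  = ⊥-elim (¬imp (λ _ → refl))
  ...     | true  | false = inj₂ (w , Pw , Qw)
  ...     | false | _     = ⊥-elim (¬imp (λ ()))

  anyV-intro : ∀ (p : Fin n → Bool) v → p v ≡ true → anyV p ≡ true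
  anyV-intro p v = any-intro p (allFin n) (∈-allFin v)

  anyV-elim : ∀ (p : Fin n → Bool) → anyV p ≡ true → ∃ λ v → p v ≡ true
  anyV-elim p = any-elim p (allFin n)

  allV-intro : ∀ (p : Fin n → Bool) → (∀ v → p v ≡ true) → allV p ≡ true
  allV-intro p = all-intro p (allFin n)

  allV-elim : ∀ (p : Fin n → Bool) v → allV p ≡ true → p v ≡ true
  allV-elim p v = all-elim p (allFin n) (∈-allFin v)

  allV-cong : ∀ (p q : Fin n → Bool) → (∀ v → p v ≡ q v) → allV p ≡ allV q
  allV-cong p q = all-cong p q (allFin n)

  sumℕ-cong : ∀ {h h′ : Fin n → ℕ} → (∀ v → h v ≡ h′ v) → sumℕ h ≡ sumℕ h′
  sumℕ-cong = sumBy-cong (allFin n)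

  sumℕ-mono : ∀ {h h′ : Fin n → ℕ} → (∀ v → h v ≤ h′ v) → sumℕ h ≤ sumℕ h′
  sumℕ-mono = sumBy-mono (allFin n)

  sumℕ-+ : ∀ (h h′ : Fin n → ℕ) → sumℕ (λ v → h v + h′ v) ≡ sumℕ h + sumℕ h′
  sumℕ-+ h h′ = sumBy-+ h h′ (allFin n)

  sumℕ-*ʳ : ∀ (h : Fin n → ℕ) c → sumℕ (λ v → h v * c) ≡ sumℕ h * c
  sumℕ-*ʳ h c = sumBy-*ʳ h c (allFin n)

  sumℕ-*ˡ : ∀ c (h : Fin n → ℕ) → sumℕ (λ v → c * h v) ≡ c * sumℕ h
  sumℕ-*ˡ c h = trans (sumℕ-cong (λ v → *-comm c (h v))) (trans (sumℕ-*ʳ h c) (*-comm (sumℕ h) c))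

  sumℕ-swap : ∀ (F : Fin n → Fin n → ℕ) → sumℕ (λ u → sumℕ (F u)) ≡ sumℕ (λ w → sumℕ (λ u → F u w))
  sumℕ-swap F = sumBy-swap F (allFin n) (allFin n)

  sumℕ≡0⇒≡0 : ∀ h → sumℕ h ≡ 0 → ∀ v → h v ≡ 0
  sumℕ≡0⇒≡0 h e v = sumBy≡0⇒≡0 h (allFin n) e (∈-allFin v)

  ≤sumℕ : ∀ h v → h v ≤ sumℕ h
  ≤sumℕ h v = ∈⇒≤sumBy h (allFin n) (∈-allFin v)

  count-cong : ∀ {p q : Fin n → Bool} → (∀ v → p v ≡ q v) → count p ≡ count q
  count-cong e = sumℕ-cong (λ v → cong ind (e v))

  count-mono : ∀ {p q : Fin n → Bool} → p ⊆ q → count p ≤ count q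
  count-mono h = sumℕ-mono (λ v → ind-mono (h v))

  count≤n : ∀ p → count p ≤ n
  count≤n p = subst (count p ≤_) (length-tabulate _)
                (sumBy≤length _ (allFin n) (λ v → ind-mono {p v} {true} (λ _ → refl)))

  count-pos : ∀ p v → p v ≡ true → 1 ≤ count p
  count-pos p v e = ≤-trans (≤-reflexive (cong ind (Eq.sym e))) (≤sumℕ (λ v → ind (p v)) v)

  count-none : ∀ p → (∀ v → p v ≡ false) → count p ≡ 0
  count-none p none = trans (count-cong none) (sumBy-zero (allFin n))

  count≡0⇒false : ∀ p → count p ≡ 0 → ∀ v → p v ≡ false
  count≡0⇒false p e v with p v in pv | sumℕ≡0⇒≡0 (λ v → ind (p v)) e v
  ... | false | _ = refl

  count-pos⇒∃ : ∀ p → 1 ≤ count p → ∃ λ v → p v ≡ true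
  count-pos⇒∃ p h with ¬∀⟶∃¬ n (λ v → p v ≡ false) (λ v → p v Bool.≟ false) all-false
    where
    all-false : ¬ (∀ v → p v ≡ false)
    all-false none = 1+n≰n (≤-trans h (≤-reflexive (count-none p none)))
  ... | v , ¬false = v , ¬-not ¬false

  count≤1 : ∀ p → (∀ a b → p a ≡ true → p b ≡ true → a ≡ b) → count p ≤ 1
  count≤1 p = sumBy-ind≤1 p (allFin n) (allFin⁺ n)

  sumOn : VSet n → (Fin n → ℕ) → ℕ
  sumOn P h = sumℕ (λ w → ind (P w) * h w)

  count≡sumOn : ∀ (p : VSet n) → count p ≡ sumOn p (λ _ → 1)
  count≡sumOn p = sumℕ-cong (λ v → Eq.sym (*-identityʳ (ind (p v))))

  sumOn-split : ∀ (P q : VSet n) h →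
                sumOn P h ≡ sumOn (λ w → P w ∧ q w) h + sumOn (λ w → P w ∧ not (q w)) h
  sumOn-split P q h = trans (sumℕ-cong (λ w → ind-split (P w) (q w) (h w))) (sumℕ-+ _ _)

  count-split : ∀ (p q : VSet n) → count p ≡ count (λ w → p w ∧ q w) + count (λ w → p w ∧ not (q w))
  count-split p q = trans (count≡sumOn p) (trans (sumOn-split p q (λ _ → 1))
    (Eq.sym (cong₂ _+_ (count≡sumOn (λ w → p w ∧ q w)) (count≡sumOn (λ w → p w ∧ not (q w))))))

  count-< : ∀ {p q : Fin n → Bool} → p ⊆ q → ∀ w → p w ≡ false → q w ≡ true → count p < count q
  count-< {p} {q} p⊆q w pw qw = begin
      1 + count p
    ≡⟨ +-comm 1 (count p) ⟩
      count p + 1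
    ≤⟨ +-mono-≤ (count-mono (λ v e → ∧-intro (p⊆q v e) e))
                (count-pos (λ v → q v ∧ not (p v)) w (∧-intro qw (false⇒not-true pw))) ⟩
      count (λ v → q v ∧ p v) + count (λ v → q v ∧ not (p v))
    ≡⟨ count-split q p ⟨
      count q ∎
    where open ≤-Reasoning

  sumOn-∪ : ∀ (P Q : VSet n) h → sumOn (P ∪ Q) h ≤ sumOn P h + sumOn Q h
  sumOn-∪ P Q h = ≤-trans (sumℕ-mono (λ w → ind-∨ (P w) (Q w) (h w))) (≤-reflexive (sumℕ-+ _ _))

  single-refl : ∀ (u : Fin n) → single u u ≡ true
  single-refl u with toℕ u ℕ.≟ toℕ u
  ... | yes _  = refl
  ... | no u≢u = ⊥-elim (u≢u refl)

  single⇒≡ : ∀ (u w : Fin n) → single u w ≡ true → u ≡ w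
  single⇒≡ u w e with toℕ u ℕ.≟ toℕ w
  ... | yes p = toℕ-injective p

  sumOn-single : ∀ (v : Fin n) h → sumOn (single v) h ≡ h v
  sumOn-single v h = begin
      sumOn (single v) h
    ≡⟨ sumℕ-cong at-v ⟩
      sumℕ (λ w → ind (single v w) * h v)
    ≡⟨ sumℕ-*ʳ (λ w → ind (single v w)) (h v) ⟩
      count (single v) * h v
    ≡⟨ cong (_* h v) count-single ⟩
      1 * h v
    ≡⟨ *-identityˡ (h v) ⟩
      h v ∎
    where
    open ≡-Reasoning
    at-v : ∀ w → ind (single v w) * h w ≡ ind (single v w) * h v
    at-v w with single v w in e
    ... | false = refl
    ... | true rewrite single⇒≡ v w e = refl
    count-single : count (single v) ≡ 1
    count-single = ≤-antisym
      (count≤1 _ (λ a b ea eb → trans (Eq.sym (single⇒≡ v a ea)) (single⇒≡ v b eb)))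
      (count-pos _ v (single-refl v))

  sumOn-remove : ∀ (P : VSet n) v h → P v ≡ true →
                 sumOn P h ≡ sumOn (λ w → P w ∧ not (single v w)) h + h v
  sumOn-remove P v h Pv = begin
      sumOn P h
    ≡⟨ sumOn-split P (single v) h ⟩
      sumOn (λ w → P w ∧ single v w) h + sumOn (λ w → P w ∧ not (single v w)) h
    ≡⟨ cong (_+ sumOn (λ w → P w ∧ not (single v w)) h)
            (trans (sumℕ-cong (λ w → cong (λ b → ind b * h w) (P∧single w))) (sumOn-single v h)) ⟩
      h v + sumOn (λ w → P w ∧ not (single v w)) h
    ≡⟨ +-comm (h v) _ ⟩
      sumOn (λ w → P w ∧ not (single v w)) h + h v ∎
    where
    open ≡-Reasoning
    P∧single : ∀ w → (P w ∧ single v w) ≡ single v w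
    P∧single w with single v w in e
    ... | false = ∧-zeroʳ (P w)
    ... | true rewrite Eq.sym (single⇒≡ v w e) | Pv = refl

  sumℤ≡sumOn : ∀ (D : VSet n) (f : Fin n → ℤ) (h : Fin n → ℕ) → (∀ v → f v ≡ + h v) →
               sumℤ D f ≡ + sumOn D h
  sumℤ≡sumOn D f h f≡ = go (allFin n)
    where
    go : ∀ xs → foldr (λ v s → (if D v then f v else + 0) ℤ.+ s) (+ 0) xs ≡
                + sumBy (λ w → ind (D w) * h w) xs
    go []       = refl
    go (x ∷ xs) with D x
    ... | true  rewrite go xs | f≡ x | +-identityʳ (h x) = refl
    ... | false rewrite go xs = refl

  isOdd-sumℕ : ∀ (h : Fin n → ℕ) → (∀ v → isOdd (h v) ≡ false) → isOdd (sumℕ h) ≡ false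
  isOdd-sumℕ h even = go (allFin n)
    where
    go : ∀ xs → isOdd (sumBy h xs) ≡ false
    go []       = refl
    go (x ∷ xs) rewrite isOdd-+ (h x) (sumBy h xs) | even x | go xs = refl

least-element : ∀ {n} (C : VSet n) u → C u ≡ true →
                ∃ λ m → C m ≡ true × (∀ x → C x ≡ true → toℕ m ≤ toℕ x)
least-element {n} C u Cu
  with ¬∀⟶∃¬-smallest n (λ w → C w ≡ false) (λ w → C w Bool.≟ false)
                         (λ none → ≡true⇒≢false Cu (none u))
... | m , ¬Cm≡false , below = m , ¬-not ¬Cm≡false , minimal
  where
  minimal : ∀ x → C x ≡ true → toℕ m ≤ toℕ x
  minimal x Cx = ≮⇒≥ λ x<m → ≡true⇒≢false Cx
    (subst (λ y → C y ≡ false)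
           (toℕ-injective (trans (toℕ-inject (fromℕ< x<m)) (toℕ-fromℕ< x<m)))
           (below (fromℕ< x<m)))

module _ {n : ℕ} (G : Graph n) where

  degMinus-∪-single : ∀ A v b → A v ≡ false →
                      degMinus G A b ≡ degMinus G (A ∪ single v) b + ind (adj G b v)
  degMinus-∪-single A v b Av = begin
      degMinus G A b
    ≡⟨ count-split p (single v) ⟩
      count (λ w → p w ∧ single v w) + count (λ w → p w ∧ not (single v w))
    ≡⟨ cong₂ _+_ at-v (count-cong elsewhere) ⟩
      ind (adj G b v) + degMinus G (A ∪ single v) b
    ≡⟨ +-comm (ind (adj G b v)) _ ⟩
      degMinus G (A ∪ single v) b + ind (adj G b v) ∎
    where
    open ≡-Reasoning
    p : Fin n → Bool
    p w = not (A w) ∧ adj G b w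
    at-v : count (λ w → p w ∧ single v w) ≡ ind (adj G b v)
    at-v = trans (count-cong only-v) (trans (sumℕ-cong (λ w → ind-∧-* (single v w) (adj G b v)))
                                            (sumOn-single v (λ _ → ind (adj G b v))))
      where
      only-v : ∀ w → (p w ∧ single v w) ≡ (single v w ∧ adj G b v)
      only-v w with single v w in e
      ... | false = ∧-zeroʳ (p w)
      ... | true rewrite Eq.sym (single⇒≡ v w e) | Av = ∧-identityʳ _
    elsewhere : ∀ w → (p w ∧ not (single v w)) ≡ (not (A w ∨ single v w) ∧ adj G b w)
    elsewhere w with A w | single v w
    ... | true  | _     = refl
    ... | false | true  = ∧-zeroʳ _
    ... | false | false = ∧-identityʳ _

  eV≡sumOn : ∀ v B → eV G v B ≡ sumOn B (λ b → ind (adj G b v))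
  eV≡sumOn v B =
    sumℕ-cong (λ b → trans (ind-∧-* (B b) (adj G v b)) (cong (λ a → ind (B b) * ind a) (sym G v b)))

module Components {n : ℕ} (G : Graph n) where

  Closed : VSet n → VSet n → Set
  Closed S C = ∀ x y → C x ≡ true → S y ≡ true → adj G x y ≡ true → C y ≡ true

  step-mono : ∀ S {P Q} → P ⊆ Q → step G S P ⊆ step G S Q
  step-mono S {P} {Q} P⊆Q w e with ∨-elim (P w) e
  ... | inj₁ Pw = ∨-introˡ _ (P⊆Q w Pw)
  ... | inj₂ e′ with anyV-elim _ (∧-conicalʳ (S w) _ e′)
  ...   | v , Pv∧adj = ∨-introʳ (Q w) (∧-intro (∧-conicalˡ (S w) _ e′)
    (anyV-intro _ v (∧-intro (P⊆Q v (∧-conicalˡ (P v) _ Pv∧adj)) (∧-conicalʳ (P v) _ Pv∧adj))))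

  iter⊆closed : ∀ S u (C : VSet n) → C u ≡ true → Closed S C → ∀ i → iter i (step G S) (single u) ⊆ C
  iter⊆closed S u C Cu cl zero    w e = subst (λ z → C z ≡ true) (single⇒≡ u w e) Cu
  iter⊆closed S u C Cu cl (suc i) w e with ∨-elim (iter i (step G S) (single u) w) e
  ... | inj₁ e′ = iter⊆closed S u C Cu cl i w e′
  ... | inj₂ e′ with anyV-elim _ (∧-conicalʳ (S w) _ e′)
  ...   | v , e″ = cl v w (iter⊆closed S u C Cu cl i v (∧-conicalˡ _ _ e″)) (∧-conicalˡ (S w) _ e′)
                     (∧-conicalʳ (iter i (step G S) (single u) v) _ e″)

  comp-least : ∀ S u (C : VSet n) → C u ≡ true → Closed S C → comp G S u ⊆ C
  comp-least S u C Cu cl = iter⊆closed S u C Cu cl n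

  iter-refl : ∀ S u i → iter i (step G S) (single u) u ≡ true
  iter-refl S u zero    = single-refl u
  iter-refl S u (suc i) = ∨-introˡ _ (iter-refl S u i)

  comp-refl : ∀ S u → comp G S u u ≡ true
  comp-refl S u = iter-refl S u n

  -- n rounds suffice: until the iteration stabilises every round adds a vertex.
  module _ (S : VSet n) (u : Fin n) where

    private
      It : ℕ → VSet n
      It i = iter i (step G S) (single u)

    iter-stable-or-large : ∀ i → It (suc i) ⊆ It i ⊎ suc i ≤ count (It i)
    iter-stable-or-large zero = inj₂ (count-pos (It 0) u (single-refl u))
    iter-stable-or-large (suc i) with ⊆-or-witness (It (suc i)) (It i) | iter-stable-or-large i
    ... | inj₁ stable          | _           = inj₁ (step-mono S stable)
    ... | inj₂ (w , new , old) | inj₁ stable = ⊥-elim (≡true⇒≢false (stable w new) old)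
    ... | inj₂ (w , new , old) | inj₂ large  =
      inj₂ (≤-trans (s≤s large) (count-< (λ v → ∨-introˡ _) w old new))

    iter-stable : It (suc n) ⊆ It n
    iter-stable with iter-stable-or-large n
    ... | inj₁ stable = stable
    ... | inj₂ large  = ⊥-elim (1+n≰n (≤-trans large (count≤n (It n))))

  comp-closed : ∀ S u → Closed S (comp G S u)
  comp-closed S u x y Cx Sy axy =
    iter-stable S u y (∨-introʳ (comp G S u y) (∧-intro Sy (anyV-intro _ x (∧-intro Cx axy))))

  comp⊆ : ∀ S u → S u ≡ true → comp G S u ⊆ S
  comp⊆ S u Su = comp-least S u S Su (λ _ _ _ Sy _ → Sy)

  comp-trans : ∀ S u w x → comp G S u w ≡ true → comp G S w x ≡ true → comp G S u x ≡ true
  comp-trans S u w x uw wx = comp-least S w (comp G S u) uw (comp-closed S u) x wx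

  comp-sym : ∀ S u w → S u ≡ true → comp G S u w ≡ true → comp G S w u ≡ true
  comp-sym S u w Su uw = ∧-conicalʳ (S w) _ (comp-least S u C (∧-intro Su (comp-refl S u)) closed w uw)
    where
    C : VSet n
    C x = S x ∧ comp G S x u
    closed : Closed S C
    closed x y Cx Sy axy = ∧-intro Sy (comp-trans S y x u
      (comp-closed S y y x (comp-refl S y) (∧-conicalˡ (S x) _ Cx) (trans (sym G y x) axy))
      (∧-conicalʳ (S x) _ Cx))

  comp-same : ∀ S u v → S u ≡ true → comp G S u v ≡ true → ∀ w → comp G S u w ≡ comp G S v w
  comp-same S u v Su uv w with comp G S u w in uw | comp G S v w in vw
  ... | true  | true  = refl
  ... | false | false = refl
  ... | true  | false = ⊥-elim (≡true⇒≢false (comp-trans S v u w (comp-sym S u v Su uv) uw) vw)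
  ... | false | true  = ⊥-elim (≡true⇒≢false (comp-trans S u v w uv vw) uw)

  comp-mono : ∀ S S′ u → S ⊆ S′ → comp G S u ⊆ comp G S′ u
  comp-mono S S′ u S⊆S′ = comp-least S u (comp G S′ u) (comp-refl S′ u)
    (λ x y Cx Sy axy → comp-closed S′ u x y Cx (S⊆S′ y Sy) axy)

  Isolated : VSet n → VSet n → Fin n → Set
  Isolated S S′ u = ∀ w y → comp G S u w ≡ true → S′ y ≡ true → S y ≡ false → adj G w y ≡ false

  comp-isolated : ∀ S S′ u → S ⊆ S′ → Isolated S S′ u → ∀ w → comp G S′ u w ≡ comp G S u w
  comp-isolated S S′ u S⊆S′ iso w with comp G S′ u w in e′ | comp G S u w in e
  ... | true  | true  = refl
  ... | false | false = refl
  ... | false | true  = ⊥-elim (≡true⇒≢false (comp-mono S S′ u S⊆S′ w e) e′)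
  ... | true  | false = ⊥-elim (≡true⇒≢false (comp-least S′ u (comp G S u) (comp-refl S u) closed w e′) e)
    where
    closed : Closed S′ (comp G S u)
    closed x y Cx S′y axy with S y in Sy
    ... | true  = comp-closed S u x y Cx Sy axy
    ... | false = ⊥-elim (≡true⇒≢false axy (iso x y Cx S′y Sy))

  isRep⇒∈ : ∀ S u → isRep G S u ≡ true → S u ≡ true
  isRep⇒∈ S u e = ∧-conicalˡ (S u) _ e

  isRep⇒≤ : ∀ S u w → isRep G S u ≡ true → comp G S u w ≡ true → toℕ u ≤ toℕ w
  isRep⇒≤ S u w e uw with ∨-elim (not (comp G S u w)) (allV-elim _ w (∧-conicalʳ (S u) _ e))
  ... | inj₁ e′ = ⊥-elim (≡true⇒≢false uw (not-true⇒false e′))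
  ... | inj₂ e′ = ≤ᵇ⇒≤ _ _ (Equivalence.from T-≡ e′)

  isRep-unique : ∀ S u₁ u₂ w → isRep G S u₁ ≡ true → isRep G S u₂ ≡ true →
                 comp G S u₁ w ≡ true → comp G S u₂ w ≡ true → u₁ ≡ u₂
  isRep-unique S u₁ u₂ w r₁ r₂ c₁ c₂ = toℕ-injective (≤-antisym
    (isRep⇒≤ S u₁ u₂ r₁ (comp-trans S u₁ w u₂ c₁ (comp-sym S u₂ w (isRep⇒∈ S u₂ r₂) c₂)))
    (isRep⇒≤ S u₂ u₁ r₂ (comp-trans S u₂ w u₁ c₂ (comp-sym S u₁ w (isRep⇒∈ S u₁ r₁) c₁))))

  isRep-isolated : ∀ S S′ u → S ⊆ S′ → S u ≡ true → Isolated S S′ u → isRep G S′ u ≡ isRep G S u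
  isRep-isolated S S′ u S⊆S′ Su iso rewrite Su | S⊆S′ u Su =
    allV-cong _ _ (λ w → cong (λ b → not b ∨ (toℕ u ≤ᵇ toℕ w)) (comp-isolated S S′ u S⊆S′ iso w))

  ∃isRep : ∀ S w → S w ≡ true → ∃ λ u → isRep G S u ≡ true × comp G S u w ≡ true
  ∃isRep S w Sw with least-element (comp G S w) w (comp-refl S w)
  ... | m , wm , least = m , ∧-intro (comp⊆ S w Sw m wm) (allV-intro _ is-least) , comp-sym S w m Sw wm
    where
    is-least : ∀ x → not (comp G S m x) ∨ (toℕ m ≤ᵇ toℕ x) ≡ true
    is-least x with comp G S m x in mx
    ... | false = refl
    ... | true  = Equivalence.to T-≡ (≤⇒≤ᵇ (least x (comp-trans S w m x wm mx)))

  count-reps-containing : ∀ S w → count (λ u → isRep G S u ∧ comp G S u w) ≡ ind (S w)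
  count-reps-containing S w with S w in Sw
  ... | true with ∃isRep S w Sw
  ...   | u , rep , uw = ≤-antisym
          (count≤1 _ (λ a b ea eb → isRep-unique S a b w (∧-conicalˡ _ _ ea) (∧-conicalˡ _ _ eb)
                                       (∧-conicalʳ (isRep G S a) _ ea) (∧-conicalʳ (isRep G S b) _ eb)))
          (count-pos _ u (∧-intro rep uw))
  count-reps-containing S w | false = count-none _ none
    where
    none : ∀ u → (isRep G S u ∧ comp G S u w) ≡ false
    none u with isRep G S u in rep | comp G S u w in uw
    ... | false | _     = refl
    ... | true  | false = refl
    ... | true  | true  = ⊥-elim (≡true⇒≢false (comp⊆ S u (isRep⇒∈ S u rep) w uw) Sw)

  sumOn-components : ∀ S φ → sumOn S φ ≡ sumOn (isRep G S) (λ u → sumOn (comp G S u) φ)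
  sumOn-components S φ = begin
      sumℕ (λ w → ind (S w) * φ w)
    ≡⟨ sumℕ-cong (λ w → cong (_* φ w) (count-reps-containing S w)) ⟨
      sumℕ (λ w → count (λ u → isRep G S u ∧ comp G S u w) * φ w)
    ≡⟨ sumℕ-cong (λ w → sumℕ-*ʳ (λ u → ind (isRep G S u ∧ comp G S u w)) (φ w)) ⟨
      sumℕ (λ w → sumℕ (λ u → ind (isRep G S u ∧ comp G S u w) * φ w))
    ≡⟨ sumℕ-swap (λ u w → ind (isRep G S u ∧ comp G S u w) * φ w) ⟨
      sumℕ (λ u → sumℕ (λ w → ind (isRep G S u ∧ comp G S u w) * φ w))
    ≡⟨ sumℕ-cong (λ u → trans (sumℕ-cong (λ w → ind-∧ (isRep G S u) (comp G S u w) (φ w)))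
                              (sumℕ-*ˡ (ind (isRep G S u)) (λ w → ind (comp G S u w) * φ w))) ⟩
      sumℕ (λ u → ind (isRep G S u) * sumOn (comp G S u) φ) ∎
    where open ≡-Reasoning

  components-adjacent-to≤ : ∀ S x →
    count (λ u → isRep G S u ∧ anyV (λ w → comp G S u w ∧ adj G x w)) ≤ count (λ w → S w ∧ adj G x w)
  components-adjacent-to≤ S x = begin
      sumℕ (λ u → ind (isRep G S u ∧ anyV (λ w → comp G S u w ∧ adj G x w)))
    ≤⟨ sumℕ-mono at-most-size ⟩
      sumOn (isRep G S) (λ u → sumOn (comp G S u) (λ w → ind (adj G x w)))
    ≡⟨ Eq.sym (sumOn-components S (λ w → ind (adj G x w))) ⟩
      sumOn S (λ w → ind (adj G x w))
    ≡⟨ sumℕ-cong (λ w → ind-∧-* (S w) (adj G x w)) ⟨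
      count (λ w → S w ∧ adj G x w) ∎
    where
    open ≤-Reasoning
    at-most-size : ∀ u → ind (isRep G S u ∧ anyV (λ w → comp G S u w ∧ adj G x w)) ≤
                         ind (isRep G S u) * sumOn (comp G S u) (λ w → ind (adj G x w))
    at-most-size u with isRep G S u | anyV (λ w → comp G S u w ∧ adj G x w) in adjacent
    ... | false | _     = z≤n
    ... | true  | false = z≤n
    ... | true  | true with anyV-elim _ adjacent
    ...   | w , uw∧xw = ≤-trans (≤-reflexive one≡)
                          (≤-trans (≤sumℕ (λ w → ind (comp G S u w) * ind (adj G x w)) w) (m≤m+n _ 0))
      where
      one≡ : 1 ≡ ind (comp G S u w) * ind (adj G x w)
      one≡ = trans (cong ind (Eq.sym uw∧xw)) (ind-∧-* (comp G S u w) (adj G x w))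

module OddComponents {n : ℕ} (G : Graph n) (f : Fin n → ℤ) (fN : Fin n → ℕ) (f≡ : ∀ v → f v ≡ + fN v)
  where
  open Components G

  weight : VSet n → Fin n → ℕ
  weight B w = fN w + eV G w B

  eG≡sumOn : ∀ (D B : VSet n) → eG G D B ≡ sumOn D (λ u → eV G u B)
  eG≡sumOn D B = sumℕ-cong (λ u → if≡ind* (D u) (eV G u B))

  isOddComp≡isOdd : ∀ (B D : VSet n) → isOddComp G f B D ≡ isOdd (sumOn D (weight B))
  isOddComp≡isOdd B D rewrite sumℤ≡sumOn D f fN f≡ | eG≡sumOn D B =
    trans (isOdd≡%2 (sumOn D fN + sumOn D (λ u → eV G u B)))
          (cong isOdd (Eq.sym (trans (sumℕ-cong (λ w → *-distribˡ-+ (ind (D w)) (fN w) (eV G w B)))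
                                     (sumℕ-+ (λ w → ind (D w) * fN w) (λ w → ind (D w) * eV G w B)))))

  isOddComp-congᴰ : ∀ B D D′ → (∀ w → D w ≡ D′ w) → isOddComp G f B D ≡ isOddComp G f B D′
  isOddComp-congᴰ B D D′ e rewrite isOddComp≡isOdd B D | isOddComp≡isOdd B D′ =
    cong isOdd (sumℕ-cong (λ w → cong (λ b → ind b * weight B w) (e w)))

  isOddComp-congᴮ : ∀ B B′ D → (∀ w y → D w ≡ true → adj G w y ≡ true → B y ≡ B′ y) →
                    isOddComp G f B D ≡ isOddComp G f B′ D
  isOddComp-congᴮ B B′ D agree rewrite isOddComp≡isOdd B D | isOddComp≡isOdd B′ D =
    cong isOdd (sumℕ-cong same)
    where
    same : ∀ w → ind (D w) * weight B w ≡ ind (D w) * weight B′ w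
    same w with D w in Dw
    ... | false = refl
    ... | true  = cong (λ m → fN w + m + 0) (count-cong same-nbr)
      where
      same-nbr : ∀ y → (B y ∧ adj G w y) ≡ (B′ y ∧ adj G w y)
      same-nbr y with adj G w y in wy
      ... | true  rewrite agree w y Dw wy = refl
      ... | false = trans (∧-zeroʳ (B y)) (Eq.sym (∧-zeroʳ (B′ y)))

  oddRep : VSet n → VSet n → Fin n → Bool
  oddRep Q B u = isRep G Q u ∧ isOddComp G f B (comp G Q u)

  oddComps : VSet n → VSet n → ℕ
  oddComps Q B = count (oddRep Q B)

  oddRep⇒isRep : ∀ Q B u → oddRep Q B u ≡ true → isRep G Q u ≡ true
  oddRep⇒isRep Q B u = ∧-conicalˡ (isRep G Q u) _

  oddRep∧⊆isRep∧ : ∀ Q B (q : Fin n → Bool) → (λ u → oddRep Q B u ∧ q u) ⊆ (λ u → isRep G Q u ∧ q u)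
  oddRep∧⊆isRep∧ Q B q u e = ∧-intro (oddRep⇒isRep Q B u (∧-conicalˡ _ _ e)) (∧-conicalʳ (oddRep Q B u) _ e)

  oddRep-isolated : ∀ Q Q′ B B′ u → Q ⊆ Q′ → Q u ≡ true → Isolated Q Q′ u →
    (∀ w y → comp G Q u w ≡ true → adj G w y ≡ true → B y ≡ B′ y) → oddRep Q′ B′ u ≡ oddRep Q B u
  oddRep-isolated Q Q′ B B′ u Q⊆Q′ Qu iso agree =
    cong₂ _∧_ (isRep-isolated Q Q′ u Q⊆Q′ Qu iso)
      (trans (isOddComp-congᴰ B′ (comp G Q′ u) (comp G Q u) (comp-isolated Q Q′ u Q⊆Q′ iso))
             (Eq.sym (isOddComp-congᴮ B B′ (comp G Q u) agree)))

  oddComps-grow : ∀ Q Q′ B B′ (q : Fin n → Bool) → Q ⊆ Q′ →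
    (∀ u → isRep G Q u ≡ true → q u ≡ false →
       Isolated Q Q′ u × (∀ w y → comp G Q u w ≡ true → adj G w y ≡ true → B y ≡ B′ y)) →
    count (λ u → oddRep Q B u ∧ not (q u)) ≤ oddComps Q′ B′
  oddComps-grow Q Q′ B B′ q Q⊆Q′ untouched = count-mono survives
    where
    survives : ∀ u → (oddRep Q B u ∧ not (q u)) ≡ true → oddRep Q′ B′ u ≡ true
    survives u e with ∧-conicalˡ (oddRep Q B u) _ e
    ... | odd with untouched u (oddRep⇒isRep Q B u odd) (not-true⇒false (∧-conicalʳ (oddRep Q B u) _ e))
    ...   | iso , agree =
      trans (oddRep-isolated Q Q′ B B′ u Q⊆Q′ (isRep⇒∈ Q u (oddRep⇒isRep Q B u odd)) iso agree) odd

  -- Removing a single vertex v from Q: components away from v survive, the component D of v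
  -- is lost, and if D − v has odd weight then some component of Q′ inside D is odd.
  module RemoveVertex (Q Q′ B : VSet n) (v : Fin n) (Q′⊆Q : Q′ ⊆ Q) (Qv : Q v ≡ true) (Q′v : Q′ v ≡ false)
                      (only-v : ∀ w → Q w ≡ true → Q′ w ≡ false → w ≡ v) where

    D : VSet n
    D = comp G Q v

    meets-D : Fin n → Bool
    meets-D u = comp G Q u v

    away-from-v : count (λ u → oddRep Q B u ∧ not (meets-D u)) ≤
                  count (λ u → oddRep Q′ B u ∧ not (meets-D u))
    away-from-v = count-mono survives
      where
      survives : ∀ u → (oddRep Q B u ∧ not (meets-D u)) ≡ true → (oddRep Q′ B u ∧ not (meets-D u)) ≡ true
      survives u e =
        ∧-intro (trans (Eq.sym (oddRep-isolated Q′ Q B B u Q′⊆Q Q′u iso (λ _ _ _ _ → refl))) odd) ∉D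
        where
        odd : oddRep Q B u ≡ true
        odd = ∧-conicalˡ (oddRep Q B u) _ e
        ∉D : not (meets-D u) ≡ true
        ∉D = ∧-conicalʳ (oddRep Q B u) _ e
        Qu : Q u ≡ true
        Qu = isRep⇒∈ Q u (oddRep⇒isRep Q B u odd)
        u≠v : ∀ w → w ≡ v → comp G Q u w ≡ true → ⊥
        u≠v w refl uv = ≡true⇒≢false uv (not-true⇒false ∉D)
        Q′u : Q′ u ≡ true
        Q′u with Q′ u in e′
        ... | true  = refl
        ... | false = ⊥-elim (u≠v u (only-v u Qu e′) (comp-refl Q u))
        iso : Isolated Q′ Q u
        iso w y uw Qy Q′y with adj G w y in wy
        ... | false = refl
        ... | true  =
          ⊥-elim (u≠v y (only-v y Qy Q′y) (comp-closed Q u w y (comp-mono Q′ Q u Q′⊆Q w uw) Qy wy))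

    at-v : count (λ u → oddRep Q B u ∧ meets-D u) ≤ ind (isOddComp G f B D)
    at-v with isOddComp G f B D in oddD
    ... | true  = ≤-trans (count-mono (oddRep∧⊆isRep∧ Q B meets-D))
                          (≤-reflexive (trans (count-reps-containing Q v) (cong ind Qv)))
    ... | false = ≤-reflexive (count-none _ none)
      where
      none : ∀ u → (oddRep Q B u ∧ meets-D u) ≡ false
      none u with oddRep Q B u in odd | meets-D u in uv
      ... | false | _     = refl
      ... | true  | false = refl
      ... | true  | true  = ⊥-elim (≡true⇒≢false
              (trans (Eq.sym (isOddComp-congᴰ B (comp G Q u) D
                                (comp-same Q u v (isRep⇒∈ Q u (oddRep⇒isRep Q B u odd)) uv)))
                     (∧-conicalʳ (isRep G Q u) _ odd))
              oddD)

    private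
      weight-in-D : Fin n → ℕ
      weight-in-D w = ind (D w) * weight B w

    even-piece : ∀ u → isRep G Q′ u ≡ true → (oddRep Q′ B u ∧ meets-D u) ≡ false →
                 isOdd (sumOn (comp G Q′ u) weight-in-D) ≡ false
    even-piece u rep not-odd-in-D with meets-D u in uv
    ... | true  =
      trans (cong isOdd (sumℕ-cong in-D)) (trans (Eq.sym (isOddComp≡isOdd B (comp G Q′ u))) even-comp)
      where
      in-D : ∀ w → ind (comp G Q′ u w) * weight-in-D w ≡ ind (comp G Q′ u w) * weight B w
      in-D w with comp G Q′ u w in uw
      ... | false = refl
      ... | true rewrite comp-trans Q v u w (comp-sym Q u v (Q′⊆Q u (isRep⇒∈ Q′ u rep)) uv)
                                            (comp-mono Q′ Q u Q′⊆Q w uw) =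
        cong (_+ 0) (+-identityʳ (weight B w))
      even-comp : isOddComp G f B (comp G Q′ u) ≡ false
      even-comp with isOddComp G f B (comp G Q′ u) in odd
      ... | false = refl
      ... | true  = ⊥-elim (≡true⇒≢false (∧-intro (∧-intro rep refl) refl) not-odd-in-D)
    ... | false = isOdd-sumℕ _ outside-D
      where
      outside-D : ∀ w → isOdd (ind (comp G Q′ u w) * weight-in-D w) ≡ false
      outside-D w with comp G Q′ u w in uw | D w in vw
      ... | false | _     = refl
      ... | true  | false = refl
      ... | true  | true  = ⊥-elim (≡true⇒≢false
            (comp-trans Q u w v (comp-mono Q′ Q u Q′⊆Q w uw) (comp-sym Q v w Qv vw)) uv)

    inside-D : ind (isOdd (sumOn (λ w → Q′ w ∧ D w) (weight B))) ≤
               count (λ u → oddRep Q′ B u ∧ meets-D u)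
    inside-D with isOdd (sumOn (λ w → Q′ w ∧ D w) (weight B)) in odd-D−v
                | count (λ u → oddRep Q′ B u ∧ meets-D u) in c
    ... | false | _     = z≤n
    ... | true  | suc _ = s≤s z≤n
    ... | true  | zero  = ⊥-elim (≡true⇒≢false odd-D−v even)
      where
      even-term : ∀ u → isOdd (ind (isRep G Q′ u) * sumOn (comp G Q′ u) weight-in-D) ≡ false
      even-term u with isRep G Q′ u in rep
      ... | false = refl
      ... | true  = trans (cong isOdd (+-identityʳ (sumOn (comp G Q′ u) weight-in-D)))
                          (even-piece u rep (count≡0⇒false _ c u))
      even : isOdd (sumOn (λ w → Q′ w ∧ D w) (weight B)) ≡ false
      even = trans (cong isOdd (trans (sumℕ-cong (λ w → ind-∧ (Q′ w) (D w) (weight B w)))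
                                      (sumOn-components Q′ weight-in-D)))
                   (isOdd-sumℕ _ even-term)

    oddComps-remove-vertex : oddComps Q B + ind (isOdd (sumOn (λ w → Q′ w ∧ D w) (weight B)))
                             ≤ oddComps Q′ B + ind (isOddComp G f B D)
    oddComps-remove-vertex = begin
        oddComps Q B + ind pv
      ≡⟨ cong (_+ ind pv) (count-split (oddRep Q B) meets-D) ⟩
        count (λ u → oddRep Q B u ∧ meets-D u) + count (λ u → oddRep Q B u ∧ not (meets-D u)) + ind pv
      ≤⟨ +-mono-≤ (+-mono-≤ at-v away-from-v) inside-D ⟩
        ind (isOddComp G f B D) + count (λ u → oddRep Q′ B u ∧ not (meets-D u))
          + count (λ u → oddRep Q′ B u ∧ meets-D u)
      ≡⟨ rearrange (ind (isOddComp G f B D)) (count (λ u → oddRep Q′ B u ∧ not (meets-D u)))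
                   (count (λ u → oddRep Q′ B u ∧ meets-D u)) ⟩
        count (λ u → oddRep Q′ B u ∧ meets-D u) + count (λ u → oddRep Q′ B u ∧ not (meets-D u))
          + ind (isOddComp G f B D)
      ≡⟨ cong (_+ ind (isOddComp G f B D)) (count-split (oddRep Q′ B) meets-D) ⟨
        oddComps Q′ B + ind (isOddComp G f B D) ∎
      where
      open ≤-Reasoning
      pv : Bool
      pv = isOdd (sumOn (λ w → Q′ w ∧ D w) (weight B))
      rearrange : ∀ a b c → a + b + c ≡ c + b + a
      rearrange = solve-∀

+-+-⊖ : ∀ a b c d → + a ℤ.- + b ℤ.+ + c ℤ.- + d ≡ (a + c) ⊖ (b + d)
+-+-⊖ a b c d = trans (regroup (+ a) (+ b) (+ c) (+ d)) (ℤ.m-n≡m⊖n (a + c) (b + d))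
  where
  regroup : ∀ (x y z w : ℤ) → x ℤ.- y ℤ.+ z ℤ.- w ≡ (x ℤ.+ z) ℤ.- (y ℤ.+ w)
  regroup = ℤ-Solver.solve-∀

⊖≤⊖ : ∀ a b c d → a + d ≤ c + b → a ⊖ b ℤ.≤ c ⊖ d
⊖≤⊖ a b c d h = subst₂ ℤ._≤_ (ℤ.+-cancelˡ-⊖ d a b)
  (trans (cong ((b + c) ⊖_) (+-comm d b)) (ℤ.+-cancelˡ-⊖ b c d))
  (ℤ.⊖-monoˡ-≤ (d + b) (subst₂ _≤_ (+-comm a d) (+-comm c b) h))

⊖<⊖ : ∀ a b c d → a + d < c + b → a ⊖ b ℤ.< c ⊖ d
⊖<⊖ a b c d h = subst₂ ℤ._<_ (ℤ.+-cancelˡ-⊖ d a b)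
  (trans (cong ((b + c) ⊖_) (+-comm d b)) (ℤ.+-cancelˡ-⊖ b c d))
  (ℤ.⊖-monoˡ-< (d + b) (subst₂ _<_ (+-comm a d) (+-comm c b) h))

-- od and pv are the parities of a component D and of D − v; the first hypothesis is their
-- relation when f(v) = 2 and e = e(v, B).
parity-gain : ∀ e pv od → od ≡ pv xor isOdd e → (od ≡ true → 2 ≤ e) → (od ≡ false → 1 ≤ e) →
              2 + ind od ≤ e + ind pv
parity-gain (suc (suc (suc e))) pv    true  _  _   _   = s≤s (s≤s (s≤s z≤n))
parity-gain (suc (suc e))       pv    false _  _   _   = s≤s (s≤s z≤n)
parity-gain 2                   true  true  _  _   _   = ≤-refl
parity-gain 1                   true  false _  _   _   = ≤-refl
parity-gain 2                   false true  () _   _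
parity-gain 1                   false false () _   _
parity-gain 1                   pv    true  _  two _   with s≤s () ← two refl
parity-gain 0                   pv    true  _  two _   with () ← two refl
parity-gain 0                   pv    false _  _   one with () ← one refl

module Theorem2p4 {n : ℕ} (G : Graph n) (side : Fin n → Bool) (k : ℕ) where

  f g : Fin n → ℤ
  f = fk side k
  g = gk side k

  fN gN : Fin n → ℕ
  fN v = if side v then 2 else k
  gN v = if side v then 0 else k

  f≡ : ∀ v → f v ≡ + fN v
  f≡ v with side v
  ... | true  = refl
  ... | false = refl

  g≡ : ∀ v → g v ≡ + gN v
  g≡ v with side v
  ... | true  = refl
  ... | false = refl

  open Components G
  open OddComponents G f fN f≡

  fA : VSet n → ℕ
  fA A = sumOn A fN

  gB : VSet n → ℕ
  gB B = sumOn B gN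

  dB : VSet n → VSet n → ℕ
  dB A B = sumOn B (degMinus G A)

  hOdd : VSet n → VSet n → ℕ
  hOdd A B = oddComps (rest A B) B

  -- Every vertex lies in W = X or has g = f, so h_W counts all odd components.
  hW≡hOdd : ∀ A B → hW G f g side A B ≡ hOdd A B
  hW≡hOdd A B = count-cong (λ u → cong (isRep G (rest A B) u ∧_)
    (trans (cong (isOddComp G f B (comp G (rest A B) u) ∧_) (allV-intro _ (W-or-tight (comp G (rest A B) u))))
           (∧-identityʳ _)))
    where
    W-or-tight : ∀ (D : VSet n) v → not (D v) ∨ side v ∨ ⌊ g v ℤ.≟ f v ⌋ ≡ true
    W-or-tight D v with side v
    ... | true = ∨-introʳ (not (D v)) refl
    ... | false with (+ k) ℤ.≟ (+ k)
    ...   | yes _  = ∨-introʳ (not (D v)) refl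
    ...   | no k≢k = ⊥-elim (k≢k refl)

  δ≡⊖ : ∀ A B → δ G f g side A B ≡ (fA A + dB A B) ⊖ (gB B + hOdd A B)
  δ≡⊖ A B rewrite sumℤ≡sumOn A f fN f≡ | sumℤ≡sumOn B g gN g≡ | hW≡hOdd A B
                | sumℕ-cong {h′ = λ b → ind (B b) * degMinus G A b}
                            (λ b → if≡ind* (B b) (degMinus G A b)) =
    +-+-⊖ (fA A) (gB B) (dB A B) (hOdd A B)

  δ≤δ : ∀ A B A′ B′ → fA A′ + dB A′ B′ + (gB B + hOdd A B) ≤ fA A + dB A B + (gB B′ + hOdd A′ B′) →
        δ G f g side A′ B′ ℤ.≤ δ G f g side A B
  δ≤δ A B A′ B′ h rewrite δ≡⊖ A B | δ≡⊖ A′ B′ =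
    ⊖≤⊖ (fA A′ + dB A′ B′) (gB B′ + hOdd A′ B′) (fA A + dB A B) (gB B + hOdd A B) h

  δ<δ : ∀ A B A′ B′ → fA A′ + dB A′ B′ + (gB B + hOdd A B) < fA A + dB A B + (gB B′ + hOdd A′ B′) →
        δ G f g side A′ B′ ℤ.< δ G f g side A B
  δ<δ A B A′ B′ h rewrite δ≡⊖ A B | δ≡⊖ A′ B′ =
    ⊖<⊖ (fA A′ + dB A′ B′) (gB B′ + hOdd A′ B′) (fA A + dB A B) (gB B + hOdd A B) h

  module DeleteFromB (A B : VSet n) (v : Fin n) (Bv : B v ≡ true) (Xv : side v ≡ true) where

    B′ : VSet n
    B′ w = B w ∧ not (single v w)

    private
      Q Q′ : VSet n
      Q = rest A B
      Q′ = rest A B′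

    Q⊆Q′ : Q ⊆ Q′
    Q⊆Q′ w e = nor-intro (nor⇒falseˡ e) (∧-falseˡ (not (single v w)) (nor⇒falseʳ (A w) e))

    Q′∖Q⊆v : ∀ y → Q′ y ≡ true → Q y ≡ false → y ≡ v
    Q′∖Q⊆v y Q′y Qy with A y | B y | single v y in vy
    Q′∖Q⊆v y ()  Qy | true  | _     | _
    Q′∖Q⊆v y Q′y () | false | false | _
    Q′∖Q⊆v y Q′y Qy | false | true  | true  = Eq.sym (single⇒≡ v y vy)
    Q′∖Q⊆v y ()  Qy | false | true  | false

    touches-v : Fin n → Bool
    touches-v u = anyV (λ w → comp G Q u w ∧ adj G v w)

    untouched : ∀ u → isRep G Q u ≡ true → touches-v u ≡ false →
                Isolated Q Q′ u × (∀ w y → comp G Q u w ≡ true → adj G w y ≡ true → B y ≡ B′ y)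
    untouched u _ far = isolated , agree
      where
      not-v : ∀ w y → comp G Q u w ≡ true → adj G w y ≡ true → y ≢ v
      not-v w y uw wy refl = ≡true⇒≢false (anyV-intro _ w (∧-intro uw (trans (sym G v w) wy))) far
      isolated : Isolated Q Q′ u
      isolated w y uw Q′y Qy with adj G w y in wy
      ... | false = refl
      ... | true  = ⊥-elim (not-v w y uw wy (Q′∖Q⊆v y Q′y Qy))
      agree : ∀ w y → comp G Q u w ≡ true → adj G w y ≡ true → B y ≡ B′ y
      agree w y uw wy with single v y in vy
      ... | false = Eq.sym (∧-identityʳ (B y))
      ... | true  = ⊥-elim (not-v w y uw wy (Eq.sym (single⇒≡ v y vy)))

    gB≡ : gB B ≡ gB B′
    gB≡ = trans (sumOn-remove B v gN Bv)
                (trans (cong (λ m → gB B′ + m) (cong (λ s → if s then 0 else k) Xv)) (+-identityʳ (gB B′)))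

    dB≡ : dB A B ≡ dB A B′ + degMinus G A v
    dB≡ = sumOn-remove B v (degMinus G A) Bv

    hOdd≤ : hOdd A B ≤ hOdd A B′ + degMinus G A v
    hOdd≤ = begin
        oddComps Q B
      ≡⟨ count-split (oddRep Q B) touches-v ⟩
        count (λ u → oddRep Q B u ∧ touches-v u) + count (λ u → oddRep Q B u ∧ not (touches-v u))
      ≤⟨ +-mono-≤ adjacent (oddComps-grow Q Q′ B B′ touches-v Q⊆Q′ untouched) ⟩
        degMinus G A v + hOdd A B′
      ≡⟨ +-comm (degMinus G A v) (hOdd A B′) ⟩
        hOdd A B′ + degMinus G A v ∎
      where
      open ≤-Reasoning
      adjacent : count (λ u → oddRep Q B u ∧ touches-v u) ≤ degMinus G A v
      adjacent = ≤-trans (count-mono (oddRep∧⊆isRep∧ Q B touches-v))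
                (≤-trans (components-adjacent-to≤ Q v) (count-mono Q∧adj⊆∁A∧adj))
        where
        Q∧adj⊆∁A∧adj : (λ w → Q w ∧ adj G v w) ⊆ (λ w → not (A w) ∧ adj G v w)
        Q∧adj⊆∁A∧adj w e = ∧-intro (false⇒not-true (nor⇒falseˡ (∧-conicalˡ (Q w) _ e))) (∧-conicalʳ (Q w) _ e)

    δ-delete-from-B : δ G f g side A B′ ℤ.≤ δ G f g side A B
    δ-delete-from-B = δ≤δ A B A B′ (begin
        fA A + dB A B′ + (gB B + hOdd A B)
      ≤⟨ +-monoʳ-≤ (fA A + dB A B′) (+-mono-≤ (≤-reflexive gB≡) hOdd≤) ⟩
        fA A + dB A B′ + (gB B′ + (hOdd A B′ + degMinus G A v))
      ≡⟨ regroup (fA A) (dB A B′) (gB B′) (hOdd A B′) (degMinus G A v) ⟩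
        fA A + (dB A B′ + degMinus G A v) + (gB B′ + hOdd A B′)
      ≡⟨ cong (λ m → fA A + m + (gB B′ + hOdd A B′)) dB≡ ⟨
        fA A + dB A B + (gB B′ + hOdd A B′) ∎)
      where
      open ≤-Reasoning
      regroup : ∀ a b c x y → a + b + (c + (x + y)) ≡ a + (b + y) + (c + x)
      regroup = solve-∀

  module MoveToA (A B : VSet n) (v : Fin n) (Qv : rest A B v ≡ true) (Xv : side v ≡ true) where

    A′ : VSet n
    A′ = A ∪ single v

    private
      Q Q′ D : VSet n
      Q = rest A B
      Q′ = rest A′ B
      D = comp G Q v

    v∉A : A v ≡ false
    v∉A = nor⇒falseˡ Qv

    v∉B : B v ≡ false
    v∉B = nor⇒falseʳ (A v) Qv

    fNv≡2 : fN v ≡ 2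
    fNv≡2 = cong (λ s → if s then 2 else k) Xv

    fA≤ : fA A′ ≤ fA A + 2
    fA≤ = ≤-trans (sumOn-∪ A (single v) fN)
                  (≤-reflexive (cong (λ m → fA A + m) (trans (sumOn-single v fN) fNv≡2)))

    dB≡ : dB A B ≡ dB A′ B + eV G v B
    dB≡ = begin
        sumOn B (degMinus G A)
      ≡⟨ sumℕ-cong (λ b → trans (cong (λ m → ind (B b) * m) (degMinus-∪-single G A v b v∉A))
                                 (*-distribˡ-+ (ind (B b)) (degMinus G A′ b) (ind (adj G b v)))) ⟩
        sumℕ (λ b → ind (B b) * degMinus G A′ b + ind (B b) * ind (adj G b v))
      ≡⟨ sumℕ-+ (λ b → ind (B b) * degMinus G A′ b) (λ b → ind (B b) * ind (adj G b v)) ⟩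
        dB A′ B + sumOn B (λ b → ind (adj G b v))
      ≡⟨ cong (λ m → dB A′ B + m) (eV≡sumOn G v B) ⟨
        dB A′ B + eV G v B ∎
      where open ≡-Reasoning

    Q′⊆Q : Q′ ⊆ Q
    Q′⊆Q w Q′w = nor-intro (∨-conicalˡ (A w) _ (nor⇒falseˡ Q′w)) (nor⇒falseʳ (A w ∨ single v w) Q′w)

    Q′v : Q′ v ≡ false
    Q′v rewrite single-refl v | ∨-zeroʳ (A v) = refl

    Q∖Q′⊆v : ∀ w → Q w ≡ true → Q′ w ≡ false → w ≡ v
    Q∖Q′⊆v w Qw Q′w with single v w in vw
    ... | true  = Eq.sym (single⇒≡ v w vw)
    ... | false = ⊥-elim (≡true⇒≢false
      (nor-intro (trans (∨-identityʳ (A w)) (nor⇒falseˡ Qw)) (nor⇒falseʳ (A w) Qw)) Q′w)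

    open RemoveVertex Q Q′ B v Q′⊆Q Qv Q′v Q∖Q′⊆v using (oddComps-remove-vertex)

    D−v≡Q′∩D : ∀ w → (D w ∧ not (single v w)) ≡ (Q′ w ∧ D w)
    D−v≡Q′∩D w with D w in Dw
    ... | false = Eq.sym (∧-zeroʳ (Q′ w))
    ... | true  = outside-A∪B (nor⇒falseˡ (comp⊆ Q v Qv w Dw)) (nor⇒falseʳ (A w) (comp⊆ Q v Qv w Dw))
      where
      outside-A∪B : ∀ {a b s} → a ≡ false → b ≡ false → not s ≡ not ((a ∨ s) ∨ b) ∧ true
      outside-A∪B {s = true}  refl refl = refl
      outside-A∪B {s = false} refl refl = refl

    parity : isOddComp G f B D ≡ isOdd (sumOn (λ w → Q′ w ∧ D w) (weight B)) xor isOdd (eV G v B)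
    parity = begin
        isOddComp G f B D
      ≡⟨ isOddComp≡isOdd B D ⟩
        isOdd (sumOn D (weight B))
      ≡⟨ cong isOdd (sumOn-remove D v (weight B) (comp-refl Q v)) ⟩
        isOdd (sumOn (λ w → D w ∧ not (single v w)) (weight B) + weight B v)
      ≡⟨ isOdd-+ (sumOn (λ w → D w ∧ not (single v w)) (weight B)) (weight B v) ⟩
        isOdd (sumOn (λ w → D w ∧ not (single v w)) (weight B)) xor isOdd (fN v + eV G v B)
      ≡⟨ cong₂ (λ s m → isOdd s xor isOdd (m + eV G v B))
               (sumℕ-cong (λ w → cong (λ b → ind b * weight B w) (D−v≡Q′∩D w))) fNv≡2 ⟩
        isOdd (sumOn (λ w → Q′ w ∧ D w) (weight B)) xor isOdd (eV G v B) ∎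
      where open ≡-Reasoning

    δ-move-to-A : (isOddComp G f B D ≡ true → 2 ≤ eV G v B) →
                  (isOddComp G f B D ≡ false → 1 ≤ eV G v B) →
                  δ G f g side A′ B ℤ.≤ δ G f g side A B
    δ-move-to-A odd-case even-case =
      δ≤δ A B A′ B (subst (λ m → fA A′ + dB A′ B + (gB B + hOdd A B) ≤ fA A + m + (gB B + hOdd A′ B))
        (Eq.sym dB≡)
        (move-arith fA≤ oddComps-remove-vertex (parity-gain _ _ _ parity odd-case even-case)))
      where
      move-arith : ∀ {fa′ fa d e gb h h′ pv od} → fa′ ≤ fa + 2 → h + pv ≤ h′ + od → 2 + od ≤ e + pv →
                   fa′ + d + (gb + h) ≤ fa + (d + e) + (gb + h′)
      move-arith {fa′} {fa} {d} {e} {gb} {h} {h′} {pv} {od} fa′≤ h≤ gain =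
        +-cancelʳ-≤ (e + pv) _ _ (begin
          fa′ + d + (gb + h) + (e + pv)
        ≤⟨ +-monoˡ-≤ (e + pv) (+-monoˡ-≤ (gb + h) (+-monoˡ-≤ d fa′≤)) ⟩
          fa + 2 + d + (gb + h) + (e + pv)
        ≡⟨ regroup₁ fa d e gb h pv ⟩
          fa + (d + e) + gb + (h + pv) + 2
        ≤⟨ +-monoˡ-≤ 2 (+-monoʳ-≤ (fa + (d + e) + gb) h≤) ⟩
          fa + (d + e) + gb + (h′ + od) + 2
        ≡⟨ regroup₂ fa (d + e) gb h′ od ⟩
          fa + (d + e) + (gb + h′) + (2 + od)
        ≤⟨ +-monoʳ-≤ (fa + (d + e) + (gb + h′)) gain ⟩
          fa + (d + e) + (gb + h′) + (e + pv) ∎)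
        where
        open ≤-Reasoning
        regroup₁ : ∀ a d e c h p → a + 2 + d + (c + h) + (e + p) ≡ a + (d + e) + c + (h + p) + 2
        regroup₁ = solve-∀
        regroup₂ : ∀ a b c h o → a + b + c + (h + o) + 2 ≡ a + b + (c + h) + (2 + o)
        regroup₂ = solve-∀

  module RemoveFromA (A B Z : VSet n) (Z⊆A∩X : ∀ v → Z v ≡ true → (A v ≡ true) × (side v ≡ true))
                     (N[Z]∩B=∅ : ∀ w → nbhd G Z w ≡ true → B w ≡ false) where

    A′ : VSet n
    A′ w = A w ∧ not (Z w)

    private
      Q Q′ : VSet n
      Q = rest A B
      Q′ = rest A′ B

    fA≡ : fA A ≡ fA A′ + 2 * count Z
    fA≡ = begin
        fA A
      ≡⟨ sumOn-split A Z fN ⟩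
        sumOn (λ w → A w ∧ Z w) fN + fA A′
      ≡⟨ cong (λ m → m + fA A′) (trans (sumℕ-cong two-on-Z) (sumℕ-*ʳ (λ w → ind (Z w)) 2)) ⟩
        count Z * 2 + fA A′
      ≡⟨ trans (+-comm (count Z * 2) (fA A′)) (cong (λ m → fA A′ + m) (*-comm (count Z) 2)) ⟩
        fA A′ + 2 * count Z ∎
      where
      open ≡-Reasoning
      two-on-Z : ∀ w → ind (A w ∧ Z w) * fN w ≡ ind (Z w) * 2
      two-on-Z w with Z w in Zw
      ... | false = cong (_* fN w) (cong ind (∧-zeroʳ (A w)))
      ... | true rewrite proj₁ (Z⊆A∩X w Zw) | proj₂ (Z⊆A∩X w Zw) = refl

    dB≡ : dB A′ B ≡ dB A B
    dB≡ = sumℕ-cong same-degree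
      where
      same-degree : ∀ b → ind (B b) * degMinus G A′ b ≡ ind (B b) * degMinus G A b
      same-degree b with B b in Bb
      ... | false = refl
      ... | true  = cong (_+ 0) (count-cong same-nbr)
        where
        same-nbr : ∀ w → (not (A w ∧ not (Z w)) ∧ adj G b w) ≡ (not (A w) ∧ adj G b w)
        same-nbr w with adj G b w in bw
        ... | false = trans (∧-zeroʳ _) (Eq.sym (∧-zeroʳ _))
        ... | true with Z w in Zw
        ...   | false = cong (λ a → not a ∧ true) (∧-identityʳ (A w))
        ...   | true  =
          ⊥-elim (≡true⇒≢false Bb (N[Z]∩B=∅ b (anyV-intro _ w (∧-intro Zw (trans (sym G w b) bw)))))

    Q⊆Q′ : Q ⊆ Q′
    Q⊆Q′ w Qw = nor-intro (∧-falseˡ (not (Z w)) (nor⇒falseˡ Qw)) (nor⇒falseʳ (A w) Qw)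

    Q′∖Q⊆Z : ∀ y → Q′ y ≡ true → Q y ≡ false → Z y ≡ true
    Q′∖Q⊆Z y Q′y Qy with A y | B y | Z y in Zy
    Q′∖Q⊆Z y Q′y Qy  | true  | false | true  = refl
    Q′∖Q⊆Z y ()  Qy  | true  | false | false
    Q′∖Q⊆Z y ()  Qy  | true  | true  | true
    Q′∖Q⊆Z y ()  Qy  | true  | true  | false
    Q′∖Q⊆Z y ()  Qy  | false | true  | _
    Q′∖Q⊆Z y Q′y ()  | false | false | _

    meets-Z : Fin n → Bool
    meets-Z u = 1 ≤ᵇ eG G Z (comp G Q u)

    untouched : ∀ u → isRep G Q u ≡ true → meets-Z u ≡ false →
                Isolated Q Q′ u × (∀ w y → comp G Q u w ≡ true → adj G w y ≡ true → B y ≡ B y)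
    untouched u _ far = isolated , (λ _ _ _ _ → refl)
      where
      no-edge : ∀ y → Z y ≡ true → count (λ w → comp G Q u w ∧ adj G y w) ≡ 0
      no-edge y Zy = trans (Eq.sym (cong (λ b → if b then count (λ w → comp G Q u w ∧ adj G y w) else 0) Zy))
                           (sumℕ≡0⇒≡0 _ (1≰ᵇ⇒0 far) y)
        where
        1≰ᵇ⇒0 : ∀ {x} → (1 ≤ᵇ x) ≡ false → x ≡ 0
        1≰ᵇ⇒0 {zero} _ = refl
      isolated : Isolated Q Q′ u
      isolated w y uw Q′y Qy with adj G w y in wy
      ... | false = refl
      ... | true  = ⊥-elim (≡true⇒≢false (∧-intro uw (trans (sym G y w) wy))
                              (count≡0⇒false _ (no-edge y (Q′∖Q⊆Z y Q′y Qy)) w))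

    hOdd≤ : hOdd A B ≤ hOdd A′ B + hZ G f A B Z
    hOdd≤ = begin
        oddComps Q B
      ≡⟨ count-split (oddRep Q B) meets-Z ⟩
        count (λ u → oddRep Q B u ∧ meets-Z u) + count (λ u → oddRep Q B u ∧ not (meets-Z u))
      ≤⟨ +-mono-≤ (≤-reflexive (count-cong (λ u → ∧-assoc (isRep G Q u) _ _)))
                  (oddComps-grow Q Q′ B B meets-Z Q⊆Q′ untouched) ⟩
        count (λ u → isRep G Q u ∧ isOddComp G f B (comp G Q u) ∧ meets-Z u) + hOdd A′ B
      ≤⟨ +-monoˡ-≤ (hOdd A′ B) (m≤n+m _ (count (λ w → nbhd G Z w ∧ B w))) ⟩
        hZ G f A B Z + hOdd A′ B
      ≡⟨ +-comm (hZ G f A B Z) (hOdd A′ B) ⟩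
        hOdd A′ B + hZ G f A B Z ∎
      where open ≤-Reasoning

    δ-remove-from-A : hZ G f A B Z < 2 * count Z → δ G f g side A′ B ℤ.< δ G f g side A B
    δ-remove-from-A hZ<2|Z| = δ<δ A B A′ B (begin-strict
        fA A′ + dB A′ B + (gB B + hOdd A B)
      ≤⟨ +-monoʳ-≤ (fA A′ + dB A′ B) (+-monoʳ-≤ (gB B) hOdd≤) ⟩
        fA A′ + dB A′ B + (gB B + (hOdd A′ B + hZ G f A B Z))
      <⟨ +-monoʳ-< (fA A′ + dB A′ B) (+-monoʳ-< (gB B) (+-monoʳ-< (hOdd A′ B) hZ<2|Z|)) ⟩
        fA A′ + dB A′ B + (gB B + (hOdd A′ B + 2 * count Z))
      ≡⟨ regroup (fA A′) (dB A′ B) (gB B) (hOdd A′ B) (count Z) ⟩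
        fA A′ + 2 * count Z + dB A′ B + (gB B + hOdd A′ B)
      ≡⟨ cong₂ (λ a d → a + d + (gB B + hOdd A′ B)) (Eq.sym fA≡) dB≡ ⟩
        fA A + dB A B + (gB B + hOdd A′ B) ∎)
      where
      open ≤-Reasoning
      regroup : ∀ a d c h x → a + d + (c + (h + 2 * x)) ≡ a + 2 * x + d + (c + h)
      regroup = solve-∀

  module Biased (bipartite : ∀ u v → adj G u v ≡ true → side u ≢ side v)
                (A B : VSet n) (biased : IsBiasedBarrier G f g side A B) where

    private
      disjoint : Disjoint A B
      disjoint = proj₁ (proj₁ biased)
      negative : δ G f g side A B ℤ.< + 0
      negative = proj₂ (proj₁ biased)

    module _ (A′ B′ : VSet n) (disjoint′ : Disjoint A′ B′) where

      private
        barrier′ : δ G f g side A′ B′ ℤ.≤ δ G f g side A B → IsBarrier G f g side A′ B′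
        barrier′ le = disjoint′ , ℤ.≤-<-trans le negative

        δ′≡δ : δ G f g side A′ B′ ℤ.≤ δ G f g side A B → δ G f g side A′ B′ ≡ δ G f g side A B
        δ′≡δ le = ℤ.≤-antisym le (proj₁ (proj₂ biased A′ B′ (barrier′ le)))

      no-smaller-δ : ¬ δ G f g side A′ B′ ℤ.< δ G f g side A B
      no-smaller-δ lt = ℤ.<-irrefl refl (ℤ.<-≤-trans lt (proj₁ (proj₂ biased A′ B′ (barrier′ (ℤ.<⇒≤ lt)))))

      no-smaller-B : δ G f g side A′ B′ ℤ.≤ δ G f g side A B → ¬ count B′ < count B
      no-smaller-B le lt = <⇒≱ lt (proj₁ (proj₂ (proj₂ biased A′ B′ (barrier′ le))) (δ′≡δ le))

      no-larger-A : δ G f g side A′ B′ ℤ.≤ δ G f g side A B → count B′ ≡ count B → ¬ count A < count A′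
      no-larger-A le eq lt = <⇒≱ lt (proj₂ (proj₂ (proj₂ biased A′ B′ (barrier′ le))) (δ′≡δ le) eq)

    B⊆Y : ∀ v → B v ≡ true → side v ≡ false
    B⊆Y v Bv with side v in Xv
    ... | false = refl
    ... | true  = ⊥-elim (no-smaller-B A B′ disjoint′ δ-delete-from-B fewer)
      where
      open DeleteFromB A B v Bv Xv
      disjoint′ : Disjoint A B′
      disjoint′ w Aw = ∧-falseˡ (not (single v w)) (disjoint w Aw)
      fewer : count B′ < count B
      fewer = count-< (λ w → ∧-conicalˡ (B w) _) v
                (trans (cong (λ b → B v ∧ not b) (single-refl v)) (∧-zeroʳ (B v))) Bv

    ∈N[B]⇒X : ∀ v → 1 ≤ eV G v B → side v ≡ true
    ∈N[B]⇒X v pos with count-pos⇒∃ (λ w → B w ∧ adj G v w) pos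
    ... | w , Bw∧vw with side v in Xv
    ...   | true  = refl
    ...   | false = ⊥-elim (bipartite v w (∧-conicalʳ (B w) _ Bw∧vw)
                             (trans Xv (Eq.sym (B⊆Y w (∧-conicalˡ (B w) _ Bw∧vw)))))

    cannot-move-to-A : ∀ v → rest A B v ≡ true → 1 ≤ eV G v B →
      (isOddComp G f B (comp G (rest A B) v) ≡ true → 2 ≤ eV G v B) →
      (isOddComp G f B (comp G (rest A B) v) ≡ false → 1 ≤ eV G v B) → ⊥
    cannot-move-to-A v Qv pos odd-case even-case =
      no-larger-A A′ B disjoint′ (δ-move-to-A odd-case even-case) refl more
      where
      open MoveToA A B v Qv (∈N[B]⇒X v pos)
      disjoint′ : Disjoint A′ B
      disjoint′ w A′w with ∨-elim (A w) A′w
      ... | inj₁ Aw = disjoint w Aw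
      ... | inj₂ vw = subst (λ z → B z ≡ false) (single⇒≡ v w vw) v∉B
      more : count A < count A′
      more = count-< (λ w → ∨-introˡ _) v v∉A (∨-introʳ (A v) (single-refl v))

    odd-component-≤1 : ∀ v → rest A B v ≡ true →
                       isOddComp G f B (comp G (rest A B) v) ≡ true → eV G v B ≤ 1
    odd-component-≤1 v Qv odd with 2 ≤? eV G v B
    ... | no  ≱2 = s≤s⁻¹ (≰⇒> ≱2)
    ... | yes ≥2 = ⊥-elim (cannot-move-to-A v Qv (≤-trans (s≤s z≤n) ≥2)
                             (λ _ → ≥2) (λ even → ⊥-elim (≡true⇒≢false odd even)))

    even-component-0 : ∀ v → rest A B v ≡ true →
                       isOddComp G f B (comp G (rest A B) v) ≡ false → eV G v B ≡ 0
    even-component-0 v Qv even with eV G v B in e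
    ... | zero  = refl
    ... | suc _ =
      ⊥-elim (cannot-move-to-A v Qv ≥1 (λ odd → ⊥-elim (≡true⇒≢false odd even)) (λ _ → ≥1))
      where
      ≥1 : 1 ≤ eV G v B
      ≥1 rewrite e = s≤s z≤n

    h[Z]≥2|Z| : ∀ (Z : VSet n) → (∀ v → Z v ≡ true → (A v ≡ true) × (side v ≡ true)) →
                (∀ w → nbhd G Z w ≡ true → B w ≡ false) → 2 * count Z ≤ hZ G f A B Z
    h[Z]≥2|Z| Z Z⊆A∩X N[Z]∩B=∅ with 2 * count Z ≤? hZ G f A B Z
    ... | yes enough = enough
    ... | no  short  = ⊥-elim (no-smaller-δ A′ B disjoint′ (δ-remove-from-A (≰⇒> short)))
      where
      open RemoveFromA A B Z Z⊆A∩X N[Z]∩B=∅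
      disjoint′ : Disjoint A′ B
      disjoint′ w A′w = disjoint w (∧-conicalˡ (A w) _ A′w)

theorem2p4 : (n : ℕ) (G : Graph n) (side : Fin n → Bool) →
    (∀ u v → adj G u v ≡ true → side u ≢ side v) →
    (k : ℕ) → 1 ≤ k → 2 ∣ (k * count (λ v → not (side v))) →
    ¬ HasPartialParityFactor G (fk side k) (gk side k) side →
    (A B : VSet n) → IsBiasedBarrier G (fk side k) (gk side k) side A B →
    (∀ v → B v ≡ true → side v ≡ false) ×
    (∀ v → rest A B v ≡ true →
       isOddComp G (fk side k) B (comp G (rest A B) v) ≡ true → eV G v B ≤ 1) ×
    (∀ v → rest A B v ≡ true →
       isOddComp G (fk side k) B (comp G (rest A B) v) ≡ false → eV G v B ≡ 0) ×
    (∀ (Z : VSet n) → (∀ v → Z v ≡ true → (A v ≡ true) × (side v ≡ true)) →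
       (∀ w → nbhd G Z w ≡ true → B w ≡ false) →
       2 * count Z ≤ hZ G (fk side k) A B Z)
theorem2p4 n G side bipartite k _ _ _ A B biased =
  B⊆Y , odd-component-≤1 , even-component-0 , h[Z]≥2|Z|
  where open Theorem2p4.Biased G side k bipartite A B biased
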